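{- Let $s\ge 2$, $t$, $t'$ be integers with $\gcd(s-1,t)$ dividing $\gcd(s-1,t')$ (in particular, this holds if $t$ divides $t'$). If an integer $r$ is distinguished with respect to $(s,t)$, then $r$ is distinguished with respect to $(s,t')$.
   Context: For integers $s$ and $r\ge 1$ with $\gcd(r,s)=1$, $\operatorname{ord}_r(s)$ denotes the least positive integer $m$ with $s^m\equiv 1\pmod r$. For integers $s\ge 2$ and $t$, an integer $r\ge 2$ is distinguished with respect to $(s,t)$ if $\gcd(r,s)=1$ and $r$ divides $t\cdot\frac{s^{\operatorname{ord}_r(s)}-1}{s-1}$. -}

module Defs where

open import Data.Nat as ℕ using (ℕ; _^_; _∸_; _≤_; _<_; NonZero)
open import Data.Nat.Divisibility as ℕD using ()
open import Data.Nat.GCD using (gcd)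
open import Data.Integer as ℤ using (ℤ; +_)
open import Data.Integer.Divisibility as ℤD using ()
open import Data.Product using (_×_; ∃-syntax)
open import Relation.Binary.PropositionalEquality using (_≡_)

-- m is the multiplicative order of s modulo r: the least positive m with
-- s^m ≡ 1 (mod r), i.e. r ∣ s^m - 1 (note s^m ≥ 1 for s ≥ 1, so ∸ is exact).
IsOrd : (r s m : ℕ) → Set
IsOrd r s m = (1 ≤ m × r ℕD.∣ (s ^ m ∸ 1))
            × (∀ k → 1 ≤ k → r ℕD.∣ (s ^ k ∸ 1) → m ≤ k)

-- (s^m - 1)/(s - 1), an exact division for s ≥ 2.
repunit : (s : ℕ) .{{_ : NonZero (s ∸ 1)}} → ℕ → ℕ
repunit s m = (s ^ m ∸ 1) ℕ./ (s ∸ 1)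

Distinguished : (s : ℕ) .{{_ : NonZero (s ∸ 1)}} → (t : ℤ) → (r : ℕ) → Set
Distinguished s t r =
  2 ≤ r × gcd r s ≡ 1 ×
  ∃[ m ] (IsOrd r s m × (+ r) ℤD.∣ (t ℤ.* (+ repunit s m)))

-- Writing s = 1 + k, the identity s^m - 1 = k·repunit s m turns s^m ≡ 1 (mod r) into
-- r ∣ k·R, where R = repunit s m.  Together with r ∣ t·R this gives r ∣ gcd(k, t)·R, and
-- gcd(k, t) divides gcd(k, t'), hence t'.
module Submission where

open import Defs
open import Data.Nat using (ℕ; _≤_; _∸_; NonZero)
open import Data.Integer using (ℤ; +_; ∣_∣)
open import Data.Integer.GCD using (gcd)
open import Data.Integer.Divisibility using (_∣_)
open import Data.Integer.Properties using (abs-*)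
open import Data.List using (_∷_; [])
open import Data.Nat as ℕ using (zero; suc; _^_)
open import Data.Nat.DivMod using (m*[n/m]≡n)
open import Data.Nat.Divisibility as ℕ using (divides; ∣-trans)
open import Data.Nat.GCD as ℕ using (c*gcd[m,n]≡gcd[cm,cn])
open import Data.Nat.Properties as ℕ using ()
open import Data.Nat.Tactic.RingSolver using (solve)
open import Data.Product using (_,_)
open import Relation.Binary.PropositionalEquality
  using (_≡_; refl; sym; cong; cong₂; subst; module ≡-Reasoning)

geometricSum : ℕ → ℕ → ℕ
geometricSum s zero    = 0
geometricSum s (suc m) = s ^ m ℕ.+ geometricSum s m

[1+k]^m≡1+geometricSum*k : ∀ k m → suc k ^ m ≡ suc (geometricSum (suc k) m ℕ.* k)
[1+k]^m≡1+geometricSum*k k zero    = refl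
[1+k]^m≡1+geometricSum*k k (suc m) = begin
  suc k ℕ.* suc k ^ m               ≡⟨ cong (suc k ℕ.*_) ih ⟩
  suc k ℕ.* suc (g ℕ.* k)           ≡⟨ [1+k][1+xk]≡1+[1+xk+x]k g ⟩
  suc ((suc (g ℕ.* k) ℕ.+ g) ℕ.* k) ≡⟨ cong (λ x → suc ((x ℕ.+ g) ℕ.* k)) ih ⟨
  suc ((suc k ^ m ℕ.+ g) ℕ.* k)     ∎
  where
  open ≡-Reasoning
  g = geometricSum (suc k) m
  ih = [1+k]^m≡1+geometricSum*k k m
  [1+k][1+xk]≡1+[1+xk+x]k : ∀ x → suc k ℕ.* suc (x ℕ.* k) ≡ suc ((suc (x ℕ.* k) ℕ.+ x) ℕ.* k)
  [1+k][1+xk]≡1+[1+xk+x]k x = solve (k ∷ x ∷ [])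

k*repunit≡[1+k]^m∸1 : ∀ k m .{{_ : NonZero k}} → k ℕ.* repunit (suc k) m ≡ suc k ^ m ∸ 1
k*repunit≡[1+k]^m∸1 k m = m*[n/m]≡n (divides (geometricSum (suc k) m)
  (cong (_∸ 1) ([1+k]^m≡1+geometricSum*k k m)))

m∣n*o∧m∣p*o⇒m∣gcd[n,p]*o : ∀ {m} n p o → m ℕ.∣ n ℕ.* o → m ℕ.∣ p ℕ.* o → m ℕ.∣ ℕ.gcd n p ℕ.* o
m∣n*o∧m∣p*o⇒m∣gcd[n,p]*o {m} n p o m∣no m∣po = subst (m ℕ.∣_) gcd[no,po]≡gcd[n,p]*o
  (ℕ.gcd-greatest m∣no m∣po)
  where
  open ≡-Reasoning
  gcd[no,po]≡gcd[n,p]*o : ℕ.gcd (n ℕ.* o) (p ℕ.* o) ≡ ℕ.gcd n p ℕ.* o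
  gcd[no,po]≡gcd[n,p]*o = begin
    ℕ.gcd (n ℕ.* o) (p ℕ.* o) ≡⟨ cong₂ ℕ.gcd (ℕ.*-comm n o) (ℕ.*-comm p o) ⟩
    ℕ.gcd (o ℕ.* n) (o ℕ.* p) ≡⟨ c*gcd[m,n]≡gcd[cm,cn] o n p ⟨
    o ℕ.* ℕ.gcd n p           ≡⟨ ℕ.*-comm o _ ⟩
    ℕ.gcd n p ℕ.* o           ∎

corollary3p3 : (s : ℕ) .{{_ : NonZero (s ∸ 1)}} → 2 ≤ s → (t t' : ℤ) →
    gcd (+ (s ∸ 1)) t ∣ gcd (+ (s ∸ 1)) t' →
    (r : ℕ) → Distinguished s t r → Distinguished s t' r
corollary3p3 (suc k) _ t t' gcd∣gcd r (2≤r , coprime , m , ord@((_ , r∣s^m∸1) , _) , r∣tR) =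
  2≤r , coprime , m , ord , subst (r ℕ.∣_) (sym (abs-* t' (+ R))) r∣∣t'∣R
  where
  R = repunit (suc k) m
  r∣kR : r ℕ.∣ k ℕ.* R
  r∣kR = subst (r ℕ.∣_) (sym (k*repunit≡[1+k]^m∸1 k m)) r∣s^m∸1
  r∣∣t∣R : r ℕ.∣ ∣ t ∣ ℕ.* R
  r∣∣t∣R = subst (r ℕ.∣_) (abs-* t (+ R)) r∣tR
  r∣∣t'∣R : r ℕ.∣ ∣ t' ∣ ℕ.* R
  r∣∣t'∣R = ∣-trans (m∣n*o∧m∣p*o⇒m∣gcd[n,p]*o k ∣ t ∣ R r∣kR r∣∣t∣R)
                    (ℕ.*-monoˡ-∣ R (∣-trans gcd∣gcd (ℕ.gcd[m,n]∣n k ∣ t' ∣)))
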